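{- Let $G=(V,E)$ be a graph. Then $$\sum_{W\subseteq V}(-1)^{|W|}\,\mathrm{ID}(G[W],x)=(1-x)^{\mathrm{iso}(G)}.$$
   Context: All graphs are finite, simple and undirected. $\mathrm{iso}(G)$ is the number of isolated vertices of $G$. $G[W]$ is the subgraph induced by $W$, and $G[\emptyset]$ is the graph with no vertices. A set $W\subseteq V$ is an independent dominating set of $G=(V,E)$ if every vertex of $V\setminus W$ is adjacent to at least one vertex of $W$ and no two vertices of $W$ are adjacent. The independent domination polynomial is $\mathrm{ID}(G,x)=\sum_{W}x^{|W|}$, the sum over all independent dominating sets $W$ of $G$. For the graph with no vertices it equals $1$. -}

module Defs where

open import Data.Nat using (ℕ; zero; suc)
open import Data.Bool using (Bool; true; false; T)
open import Data.Integer using (ℤ; +_; -_) renaming (_+_ to _+ℤ_; _*_ to _*ℤ_)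
open import Data.List using (List; []; _∷_; map; filter; length; foldr; replicate; _++_)
open import Data.Vec using (Vec; []; _∷_)
open import Data.Fin using (Fin)
open import Data.Fin.Subset using (Subset; _∈_; _∉_; _⊆_; ∣_∣)
open import Data.Fin.Subset.Properties using (_∈?_; _⊆?_)
open import Data.Fin.Properties using (all?; any?)
open import Data.Product using (Σ; _×_; _,_)
open import Relation.Nullary using (¬_; Dec; yes; no)
open import Relation.Nullary.Decidable using (_×-dec_; _→-dec_; ¬?)
open import Relation.Binary.PropositionalEquality using (_≡_)

record Graph (n : ℕ) : Set where
  field
    adj   : Fin n → Fin n → Bool
    sym   : ∀ u v → adj u v ≡ adj v u
    irrefl : ∀ v → adj v v ≡ false

open Graph public

Adj : ∀ {n} → Graph n → Fin n → Fin n → Set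
Adj G u v = T (adj G u v)

Adj? : ∀ {n} (G : Graph n) u v → Dec (Adj G u v)
Adj? G u v = Data.Bool.T? (adj G u v)
  where import Data.Bool

-- The vertex set of G[W] is W, and two vertices of W are adjacent in
-- G[W] iff they are adjacent in G.

Independent : ∀ {n} → Graph n → Subset n → Set
Independent G U = ∀ u v → u ∈ U → v ∈ U → ¬ Adj G u v

Dominates : ∀ {n} → Graph n → Subset n → Subset n → Set
Dominates G W U = ∀ v → v ∈ W → v ∉ U → Σ (Fin _) λ u → u ∈ U × Adj G u v

IsIDS : ∀ {n} → Graph n → Subset n → Subset n → Set
IsIDS G W U = U ⊆ W × Independent G U × Dominates G W U

Independent? : ∀ {n} (G : Graph n) U → Dec (Independent G U)
Independent? G U =
  all? λ u → all? λ v → (u ∈? U) →-dec ((v ∈? U) →-dec ¬? (Adj? G u v))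

Dominates? : ∀ {n} (G : Graph n) W U → Dec (Dominates G W U)
Dominates? G W U =
  all? λ v → (v ∈? W) →-dec (¬? (v ∈? U) →-dec
    any? λ u → (u ∈? U) ×-dec Adj? G u v)

IsIDS? : ∀ {n} (G : Graph n) W U → Dec (IsIDS G W U)
IsIDS? G W U = (U ⊆? W) ×-dec (Independent? G U ×-dec Dominates? G W U)

allSubsets : (n : ℕ) → List (Subset n)
allSubsets zero = [] ∷ []
allSubsets (suc n) =
  map (Data.Bool.false ∷_) (allSubsets n) ++ map (Data.Bool.true ∷_) (allSubsets n)
  where import Data.Bool

-- Polynomials over ℤ as coefficient lists (constant term first).

Poly : Set
Poly = List ℤ

coeff : Poly → ℕ → ℤ
coeff []       _       = + 0
coeff (a ∷ p)  zero    = a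
coeff (a ∷ p)  (suc k) = coeff p k

infixl 6 _⊕_
infixl 7 _⊗_ _·_

_⊕_ : Poly → Poly → Poly
[]      ⊕ q       = q
(a ∷ p) ⊕ []      = a ∷ p
(a ∷ p) ⊕ (b ∷ q) = (a +ℤ b) ∷ (p ⊕ q)

_·_ : ℤ → Poly → Poly
c · p = map (c *ℤ_) p

_⊗_ : Poly → Poly → Poly
[]      ⊗ q = []
(a ∷ p) ⊗ q = (a · q) ⊕ (+ 0 ∷ (p ⊗ q))

X^ : ℕ → Poly
X^ k = replicate k (+ 0) ++ (+ 1 ∷ [])

_^ᵖ_ : Poly → ℕ → Poly
p ^ᵖ zero  = + 1 ∷ []
p ^ᵖ suc m = p ⊗ (p ^ᵖ m)

polySum : List Poly → Poly
polySum = foldr _⊕_ []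

infix 4 _≈ᵖ_
_≈ᵖ_ : Poly → Poly → Set
p ≈ᵖ q = ∀ k → coeff p k ≡ coeff q k

sign : ℕ → ℤ
sign zero    = + 1
sign (suc m) = - sign m

ID : ∀ {n} → Graph n → Subset n → Poly
ID {n} G W = polySum (map (λ U → X^ ∣ U ∣) (filter (IsIDS? G W) (allSubsets n)))

Isolated : ∀ {n} → Graph n → Fin n → Set
Isolated G v = ∀ u → ¬ Adj G v u

iso : ∀ {n} → Graph n → ℕ
iso {n} G = length (filter (λ v → all? λ u → ¬? (Adj? G v u)) (allFin n))
  where open import Data.List using (allFin)

module Submission where

-- Write [P] ∈ {0,1} for the indicator of a decidable proposition P and
-- compare coefficients of x^k.  Expanding ID(G[W], x) as a sum over
-- subsets U and exchanging the two sums, the coefficient of x^k on the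
-- left is  Σ_U [|U| = k] · Σ_W (-1)^|W| [U is an IDS of G[W]].
-- For a fixed U the condition "U is an IDS of G[W]" is: U is independent,
-- and for every vertex v a local condition on whether v ∈ W holds
-- (v ∈ U forces v ∈ W; v ∈ W ∖ U needs a neighbour in U).  A signed sum
-- over W of a product of per-vertex factors is itself a product
-- (alternating-product), and evaluating the factors shows that the inner
-- sum is (-1)^|U| [every vertex of U is isolated] (alternating-IDS).
-- Finally Σ_{U ⊆ B} (-1)^|U| x^|U| = (1 - x)^|B| for any decidable set B
-- of vertices (alternating-within), by induction on the number of
-- vertices.

open import Defs
open import Data.Nat using (ℕ)
open import Data.List using (map)
open import Data.Integer using (+_; -_)
open import Data.List using (List; []; _∷_)
open import Data.Fin.Subset using (∣_∣)

open import Data.Nat using (zero; suc)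
open import Data.Integer using (ℤ; _+_; _*_; _-_; 0ℤ; 1ℤ; -1ℤ)
open import Data.Integer.Properties
  using (+-identityˡ; +-identityʳ; +-assoc; *-identityˡ; *-identityʳ; *-zeroʳ; neg-distribˡ-*; -1*i≡-i; *-1-commutativeMonoid)
open import Data.Integer.Tactic.RingSolver using (solve-∀)
open import Data.Bool using (Bool; true; false)
open import Data.List using (filter; foldr; _++_; length; tabulate)
open import Data.List.Properties using (map-++; map-∘)
open import Data.Vec using (lookup; here; there) renaming ([] to []ᵥ; _∷_ to _∷ᵥ_)
open import Data.Vec.Properties using ([]=⇒lookup; lookup⇒[]=)
open import Data.Fin using (Fin) renaming (zero to 0F; suc to sucF)
open import Data.Fin.Subset using (Subset; _∈_; _∉_)
open import Data.Fin.Subset.Properties using (_∈?_)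
open import Data.Fin.Properties using (all?; any?)
open import Data.Product using (Σ; _×_; _,_; proj₁; proj₂)
open import Data.Sum using (_⊎_; inj₁; inj₂)
open import Data.Empty using (⊥; ⊥-elim)
open import Function using (_∘_)
open import Relation.Nullary using (¬_; Dec; yes; no)
open import Relation.Nullary.Decidable using (_×-dec_; _→-dec_; ¬?)
open import Relation.Binary.PropositionalEquality
  using (_≡_; refl; trans; cong; cong₂; module ≡-Reasoning)
  renaming (sym to ≡-sym)
import Data.Bool.Properties as Bool

-- Finite products of integers indexed by Fin n, from the library.
open import Algebra.Properties.CommutativeMonoid.Sum *-1-commutativeMonoid
  using () renaming (sum to ∏; sum-cong-≗ to ∏-cong; ∑-distrib-+ to ∏-distrib-*)

oneMinusX : Poly
oneMinusX = + 1 ∷ - (+ 1) ∷ []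

-- δ m k = [m = k], the coefficient of x^k in x^m.
δ : ℕ → ℕ → ℤ
δ m k = coeff (X^ m) k

𝟙 : ∀ {A : Set} → Dec A → ℤ
𝟙 (yes _) = 1ℤ
𝟙 (no _)  = 0ℤ

𝟙-⇔ : ∀ {A B : Set} → (A → B) → (B → A) → (a : Dec A) (b : Dec B) → 𝟙 a ≡ 𝟙 b
𝟙-⇔ f g (yes _) (yes _) = refl
𝟙-⇔ f g (yes a) (no ¬b) = ⊥-elim (¬b (f a))
𝟙-⇔ f g (no ¬a) (yes b) = ⊥-elim (¬a (g b))
𝟙-⇔ f g (no _)  (no _)  = refl

𝟙-yes : ∀ {A : Set} → A → (a : Dec A) → 𝟙 a ≡ 1ℤ
𝟙-yes a (yes _) = refl
𝟙-yes a (no ¬a) = ⊥-elim (¬a a)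

𝟙-no : ∀ {A : Set} → ¬ A → (a : Dec A) → 𝟙 a ≡ 0ℤ
𝟙-no ¬a (yes a) = ⊥-elim (¬a a)
𝟙-no ¬a (no _)  = refl

𝟙-¬ : ∀ {A B : Set} → (¬ B → A) → (A → ¬ B) → (a : Dec A) (b : Dec B) → 𝟙 a ≡ 1ℤ - 𝟙 b
𝟙-¬ f g (yes a)  (yes b) = ⊥-elim (g a b)
𝟙-¬ f g (yes _)  (no _)  = refl
𝟙-¬ f g (no _)   (yes _) = refl
𝟙-¬ f g (no ¬a)  (no ¬b) = ⊥-elim (¬a (f ¬b))

𝟙-× : ∀ {A B : Set} (a : Dec A) (b : Dec B) (ab : Dec (A × B)) → 𝟙 a * 𝟙 b ≡ 𝟙 ab
𝟙-× (yes a) (yes b) ab = ≡-sym (𝟙-yes (a , b) ab)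
𝟙-× (yes _) (no ¬b) ab = ≡-sym (𝟙-no (¬b ∘ proj₂) ab)
𝟙-× (no ¬a) b       ab = ≡-sym (𝟙-no (¬a ∘ proj₁) ab)

𝟙-∀ : ∀ {n} {B : Fin n → Set} (b : ∀ v → Dec (B v)) (all : Dec (∀ v → B v)) →
  ∏ (λ v → 𝟙 (b v)) ≡ 𝟙 all
𝟙-∀ {zero}  b all = ≡-sym (𝟙-yes (λ ()) all)
𝟙-∀ {suc n} {B} b all with b 0F
... | yes b₀ = trans (*-identityˡ _) (trans (𝟙-∀ (b ∘ sucF) rest)
      (𝟙-⇔ (λ h → λ { 0F → b₀ ; (sucF v) → h v }) (λ h → h ∘ sucF) rest all))
  where
  rest : Dec (∀ v → B (sucF v))
  rest = all? (b ∘ sucF)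
... | no ¬b₀ = ≡-sym (𝟙-no (λ h → ¬b₀ (h 0F)) all)

Σₛ : ∀ {n} → (Subset n → ℤ) → ℤ
Σₛ {zero}  f = f []ᵥ
Σₛ {suc n} f = Σₛ (λ W → f (false ∷ᵥ W)) + Σₛ (λ W → f (true ∷ᵥ W))

Σₛ-cong : ∀ {n} {f g : Subset n → ℤ} → (∀ W → f W ≡ g W) → Σₛ f ≡ Σₛ g
Σₛ-cong {zero}  e = e []ᵥ
Σₛ-cong {suc n} e = cong₂ _+_ (Σₛ-cong (e ∘ (false ∷ᵥ_))) (Σₛ-cong (e ∘ (true ∷ᵥ_)))

Σₛ-+ : ∀ {n} (f g : Subset n → ℤ) → Σₛ (λ W → f W + g W) ≡ Σₛ f + Σₛ g
Σₛ-+ {zero}  f g = refl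
Σₛ-+ {suc n} f g = trans
  (cong₂ _+_ (Σₛ-+ (f ∘ (false ∷ᵥ_)) (g ∘ (false ∷ᵥ_))) (Σₛ-+ (f ∘ (true ∷ᵥ_)) (g ∘ (true ∷ᵥ_))))
  (interchange (Σₛ (f ∘ (false ∷ᵥ_))) (Σₛ (g ∘ (false ∷ᵥ_))) (Σₛ (f ∘ (true ∷ᵥ_))) (Σₛ (g ∘ (true ∷ᵥ_))))
  where
  interchange : ∀ a b c d → (a + b) + (c + d) ≡ (a + c) + (b + d)
  interchange = solve-∀

Σₛ-* : ∀ {n} (c : ℤ) (f : Subset n → ℤ) → Σₛ (λ W → c * f W) ≡ c * Σₛ f
Σₛ-* {zero}  c f = refl
Σₛ-* {suc n} c f = trans
  (cong₂ _+_ (Σₛ-* c (f ∘ (false ∷ᵥ_))) (Σₛ-* c (f ∘ (true ∷ᵥ_))))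
  (distrib c _ _)
  where
  distrib : ∀ a b d → a * b + a * d ≡ a * (b + d)
  distrib = solve-∀

Σₛ-zero : ∀ {n} → Σₛ {n} (λ _ → 0ℤ) ≡ 0ℤ
Σₛ-zero {n} = Σₛ-* {n} 0ℤ (λ _ → 0ℤ)

Σₛ-swap : ∀ {n m} (h : Subset n → Subset m → ℤ) →
  Σₛ (λ W → Σₛ (λ U → h W U)) ≡ Σₛ (λ U → Σₛ (λ W → h W U))
Σₛ-swap {zero}  h = refl
Σₛ-swap {suc n} h = trans
  (cong₂ _+_ (Σₛ-swap (h ∘ (false ∷ᵥ_))) (Σₛ-swap (h ∘ (true ∷ᵥ_))))
  (≡-sym (Σₛ-+ (λ U → Σₛ (λ W → h (false ∷ᵥ W) U)) (λ U → Σₛ (λ W → h (true ∷ᵥ W) U))))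

sumℤ : List ℤ → ℤ
sumℤ = foldr _+_ 0ℤ

sumℤ-++ : ∀ xs ys → sumℤ (xs ++ ys) ≡ sumℤ xs + sumℤ ys
sumℤ-++ []       ys = ≡-sym (+-identityˡ (sumℤ ys))
sumℤ-++ (x ∷ xs) ys = trans (cong (_+_ x) (sumℤ-++ xs ys)) (≡-sym (+-assoc x (sumℤ xs) (sumℤ ys)))

sumℤ-filter : ∀ {A : Set} {P : A → Set} (P? : ∀ x → Dec (P x)) (f : A → ℤ) (L : List A) →
  sumℤ (map f (filter P? L)) ≡ sumℤ (map (λ x → 𝟙 (P? x) * f x) L)
sumℤ-filter P? f []      = refl
sumℤ-filter P? f (x ∷ L) with P? x
... | yes _ = cong₂ _+_ (≡-sym (*-identityˡ (f x))) (sumℤ-filter P? f L)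
... | no _  = trans (sumℤ-filter P? f L) (≡-sym (+-identityˡ _))

sumℤ-allSubsets : ∀ n (f : Subset n → ℤ) → sumℤ (map f (allSubsets n)) ≡ Σₛ f
sumℤ-allSubsets zero    f = +-identityʳ (f []ᵥ)
sumℤ-allSubsets (suc n) f = begin
    sumℤ (map f (map (false ∷ᵥ_) A ++ map (true ∷ᵥ_) A))
      ≡⟨ cong sumℤ (map-++ f (map (false ∷ᵥ_) A) (map (true ∷ᵥ_) A)) ⟩
    sumℤ (map f (map (false ∷ᵥ_) A) ++ map f (map (true ∷ᵥ_) A))
      ≡⟨ sumℤ-++ (map f (map (false ∷ᵥ_) A)) _ ⟩
    sumℤ (map f (map (false ∷ᵥ_) A)) + sumℤ (map f (map (true ∷ᵥ_) A))
      ≡⟨ cong₂ _+_ (cong sumℤ (≡-sym (map-∘ A))) (cong sumℤ (≡-sym (map-∘ A))) ⟩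
    sumℤ (map (f ∘ (false ∷ᵥ_)) A) + sumℤ (map (f ∘ (true ∷ᵥ_)) A)
      ≡⟨ cong₂ _+_ (sumℤ-allSubsets n _) (sumℤ-allSubsets n _) ⟩
    Σₛ f ∎
  where
  open ≡-Reasoning
  A : List (Subset n)
  A = allSubsets n

coeff-⊕ : ∀ p q k → coeff (p ⊕ q) k ≡ coeff p k + coeff q k
coeff-⊕ []      q       k       = ≡-sym (+-identityˡ (coeff q k))
coeff-⊕ (a ∷ p) []      k       = ≡-sym (+-identityʳ (coeff (a ∷ p) k))
coeff-⊕ (a ∷ p) (b ∷ q) zero    = refl
coeff-⊕ (a ∷ p) (b ∷ q) (suc k) = coeff-⊕ p q k

coeff-· : ∀ c p k → coeff (c · p) k ≡ c * coeff p k
coeff-· c []      k       = ≡-sym (*-zeroʳ c)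
coeff-· c (a ∷ p) zero    = refl
coeff-· c (a ∷ p) (suc k) = coeff-· c p k

coeff-polySum : ∀ {A : Set} (g : A → Poly) (L : List A) k →
  coeff (polySum (map g L)) k ≡ sumℤ (map (λ x → coeff (g x) k) L)
coeff-polySum g []      k = refl
coeff-polySum g (x ∷ L) k =
  trans (coeff-⊕ (g x) (polySum (map g L)) k) (cong (_+_ (coeff (g x) k)) (coeff-polySum g L k))

-- shift f is the coefficient sequence of x · f.
shift : (ℕ → ℤ) → ℕ → ℤ
shift f zero    = 0ℤ
shift f (suc k) = f k

shift-cong : ∀ {f g : ℕ → ℤ} → (∀ k → f k ≡ g k) → ∀ k → shift f k ≡ shift g k
shift-cong e zero    = refl
shift-cong e (suc k) = e k

coeff-x· : ∀ p k → coeff (0ℤ ∷ p) k ≡ shift (coeff p) k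
coeff-x· p zero    = refl
coeff-x· p (suc k) = refl

coeff-linear-⊗ : ∀ a b q k →
  coeff ((a ∷ b ∷ []) ⊗ q) k ≡ a * coeff q k + b * shift (coeff q) k
coeff-linear-⊗ a b q k = begin
    coeff ((a · q) ⊕ (0ℤ ∷ ((b · q) ⊕ (0ℤ ∷ [])))) k
      ≡⟨ coeff-⊕ (a · q) _ k ⟩
    coeff (a · q) k + coeff (0ℤ ∷ ((b · q) ⊕ (0ℤ ∷ []))) k
      ≡⟨ cong₂ _+_ (coeff-· a q k) (coeff-x· _ k) ⟩
    a * coeff q k + shift (coeff ((b · q) ⊕ (0ℤ ∷ []))) k
      ≡⟨ cong (_+_ (a * coeff q k)) (shift-cong bq k) ⟩
    a * coeff q k + shift (λ j → b * coeff q j) k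
      ≡⟨ cong (_+_ (a * coeff q k)) (shift-* k) ⟩
    a * coeff q k + b * shift (coeff q) k ∎
  where
  open ≡-Reasoning
  zeroPoly : ∀ j → coeff (0ℤ ∷ []) j ≡ 0ℤ
  zeroPoly zero    = refl
  zeroPoly (suc j) = refl
  bq : ∀ j → coeff ((b · q) ⊕ (0ℤ ∷ [])) j ≡ b * coeff q j
  bq j = trans (coeff-⊕ (b · q) (0ℤ ∷ []) j)
    (trans (cong₂ _+_ (coeff-· b q j) (zeroPoly j)) (+-identityʳ _))
  shift-* : ∀ j → shift (λ i → b * coeff q i) j ≡ b * shift (coeff q) j
  shift-* zero    = ≡-sym (*-zeroʳ b)
  shift-* (suc j) = refl

alternating-product : ∀ {n} (c : Fin n → Bool → ℤ) →
  Σₛ (λ W → sign ∣ W ∣ * ∏ (λ v → c v (lookup W v))) ≡ ∏ (λ v → c v false - c v true)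
alternating-product {zero}  c = refl
alternating-product {suc n} c = begin
    Σₛ (λ W → sign ∣ W ∣ * (c 0F false * P W)) + Σₛ (λ W → - sign ∣ W ∣ * (c 0F true * P W))
      ≡⟨ cong₂ _+_ (Σₛ-cong (λ W → reorder (sign ∣ W ∣) (c 0F false) (P W)))
                   (Σₛ-cong (λ W → reorder⁻ (sign ∣ W ∣) (c 0F true) (P W))) ⟩
    Σₛ (λ W → c 0F false * S W) + Σₛ (λ W → - c 0F true * S W)
      ≡⟨ cong₂ _+_ (Σₛ-* (c 0F false) S) (Σₛ-* (- c 0F true) S) ⟩
    c 0F false * Σₛ S + - c 0F true * Σₛ S
      ≡⟨ collect (c 0F false) (c 0F true) (Σₛ S) ⟩
    (c 0F false - c 0F true) * Σₛ S
      ≡⟨ cong ((c 0F false - c 0F true) *_) (alternating-product (c ∘ sucF)) ⟩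
    ∏ (λ v → c v false - c v true) ∎
  where
  open ≡-Reasoning
  P S : Subset n → ℤ
  P W = ∏ (λ v → c (sucF v) (lookup W v))
  S W = sign ∣ W ∣ * P W
  reorder : ∀ s a p → s * (a * p) ≡ a * (s * p)
  reorder = solve-∀
  reorder⁻ : ∀ s a p → - s * (a * p) ≡ - a * (s * p)
  reorder⁻ = solve-∀
  collect : ∀ a b s → a * s + - b * s ≡ (a - b) * s
  collect = solve-∀

AllIn : ∀ {n} → Subset n → (Fin n → Set) → Set
AllIn U B = ∀ v → v ∈ U → B v

allIn? : ∀ {n} {B : Fin n → Set} (U : Subset n) → (∀ v → Dec (B v)) → Dec (AllIn U B)
allIn? U b = all? (λ v → (v ∈? U) →-dec b v)

count : ∀ {n} {B : Fin n → Set} → (∀ v → Dec (B v)) → ℕ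
count {zero}  b = 0
count {suc n} b with b 0F
... | yes _ = suc (count (b ∘ sucF))
... | no _  = count (b ∘ sucF)

length-filter-tabulate : ∀ {n} {A : Set} {P : A → Set} (P? : ∀ x → Dec (P x)) (f : Fin n → A) →
  length (filter P? (tabulate f)) ≡ count (P? ∘ f)
length-filter-tabulate {zero}  P? f = refl
length-filter-tabulate {suc n} P? f with P? (f 0F)
... | yes _ = cong suc (length-filter-tabulate P? (f ∘ sucF))
... | no _  = length-filter-tabulate P? (f ∘ sucF)

allIn-false : ∀ {n} {B : Fin (suc n) → Set} (b : ∀ v → Dec (B v)) U →
  𝟙 (allIn? (false ∷ᵥ U) b) ≡ 𝟙 (allIn? U (b ∘ sucF))
allIn-false b U = 𝟙-⇔ (λ h v v∈U → h (sucF v) (there v∈U))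
  (λ { h (sucF v) (there v∈U) → h v v∈U }) (allIn? (false ∷ᵥ U) b) (allIn? U (b ∘ sucF))

allIn-true : ∀ {n} {B : Fin (suc n) → Set} (b : ∀ v → Dec (B v)) U →
  𝟙 (allIn? (true ∷ᵥ U) b) ≡ 𝟙 (b 0F) * 𝟙 (allIn? U (b ∘ sucF))
allIn-true b U = trans
  (𝟙-⇔ (λ h → h 0F here , λ v v∈U → h (sucF v) (there v∈U))
       (λ { (b₀ , h) 0F here → b₀ ; (b₀ , h) (sucF v) (there v∈U) → h v v∈U })
       (allIn? (true ∷ᵥ U) b) (b 0F ×-dec allIn? U (b ∘ sucF)))
  (≡-sym (𝟙-× (b 0F) (allIn? U (b ∘ sucF)) _))

alternatingWithin : ∀ {n} {B : Fin n → Set} → (∀ v → Dec (B v)) → ℕ → ℤ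
alternatingWithin b k = Σₛ (λ U → δ ∣ U ∣ k * (sign ∣ U ∣ * 𝟙 (allIn? U b)))

alternatingWithin-step : ∀ {n} {B : Fin (suc n) → Set} (b : ∀ v → Dec (B v)) k →
  alternatingWithin b k
    ≡ alternatingWithin (b ∘ sucF) k - 𝟙 (b 0F) * shift (alternatingWithin (b ∘ sucF)) k
alternatingWithin-step {n} b k = cong₂ _+_
  (Σₛ-cong (λ U → cong (λ t → δ ∣ U ∣ k * (sign ∣ U ∣ * t)) (allIn-false b U)))
  (withVertex0 k)
  where
  t₀ : ℤ
  t₀ = 𝟙 (b 0F)
  I : Subset n → ℤ
  I U = 𝟙 (allIn? U (b ∘ sucF))
  withVertex0 : ∀ k →
    Σₛ (λ U → δ (suc ∣ U ∣) k * (- sign ∣ U ∣ * 𝟙 (allIn? (true ∷ᵥ U) b)))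
      ≡ - (t₀ * shift (alternatingWithin (b ∘ sucF)) k)
  withVertex0 zero = trans (Σₛ-cong {n} {g = λ _ → 0ℤ} (λ U → refl)) (trans (Σₛ-zero {n}) (≡-sym (cong -_ (*-zeroʳ t₀))))
  withVertex0 (suc k) = trans
    (Σₛ-cong (λ U → trans (cong (λ t → δ ∣ U ∣ k * (- sign ∣ U ∣ * t)) (allIn-true b U))
                          (reorder (δ ∣ U ∣ k) (sign ∣ U ∣) t₀ (I U))))
    (trans (Σₛ-* (- t₀) (λ U → δ ∣ U ∣ k * (sign ∣ U ∣ * I U))) (≡-sym (neg-distribˡ-* t₀ _)))
    where
    reorder : ∀ d s t i → d * (- s * (t * i)) ≡ - t * (d * (s * i))
    reorder = solve-∀

coeff-power-step : ∀ {n} {B : Fin (suc n) → Set} (b : ∀ v → Dec (B v)) k →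
  coeff (oneMinusX ^ᵖ count b) k
    ≡ coeff (oneMinusX ^ᵖ count (b ∘ sucF)) k - 𝟙 (b 0F) * shift (coeff (oneMinusX ^ᵖ count (b ∘ sucF))) k
coeff-power-step b k with b 0F
... | yes _ = trans (coeff-linear-⊗ (+ 1) (- (+ 1)) q k) (unit (coeff q k) (shift (coeff q) k))
  where
  q : Poly
  q = oneMinusX ^ᵖ count (b ∘ sucF)
  unit : ∀ a c → + 1 * a + - (+ 1) * c ≡ a - + 1 * c
  unit = solve-∀
... | no _ = ≡-sym (noop (coeff q k) (shift (coeff q) k))
  where
  q : Poly
  q = oneMinusX ^ᵖ count (b ∘ sucF)
  noop : ∀ a c → a - 0ℤ * c ≡ a
  noop = solve-∀

alternating-within : ∀ {n} {B : Fin n → Set} (b : ∀ v → Dec (B v)) k →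
  alternatingWithin b k ≡ coeff (oneMinusX ^ᵖ count b) k
alternating-within {zero}  b k =
  trans (cong (λ t → δ 0 k * (1ℤ * t)) (𝟙-yes (λ _ ()) (allIn? []ᵥ b))) (*-identityʳ (δ 0 k))
alternating-within {suc n} {B} b k = begin
    alternatingWithin b k
      ≡⟨ alternatingWithin-step b k ⟩
    alternatingWithin b' k - 𝟙 (b 0F) * shift (alternatingWithin b') k
      ≡⟨ cong₂ (λ p q → p - 𝟙 (b 0F) * q) (alternating-within b' k)
               (shift-cong (alternating-within b') k) ⟩
    coeff q k - 𝟙 (b 0F) * shift (coeff q) k
      ≡⟨ ≡-sym (coeff-power-step b k) ⟩
    coeff (oneMinusX ^ᵖ count b) k ∎
  where
  open ≡-Reasoning
  b' : ∀ v → Dec (B (sucF v))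
  b' = b ∘ sucF
  q : Poly
  q = oneMinusX ^ᵖ count b'

isolated? : ∀ {n} (G : Graph n) v → Dec (Isolated G v)
isolated? G v = all? (λ u → ¬? (Adj? G v u))

iso≡count : ∀ {n} (G : Graph n) → iso G ≡ count (isolated? G)
iso≡count G = length-filter-tabulate (isolated? G) (λ v → v)

membership : ∀ {n} (v : Fin n) (U : Subset n) →
  (v ∈ U × lookup U v ≡ true) ⊎ (v ∉ U × lookup U v ≡ false)
membership v U with lookup U v in eq
... | true  = inj₁ (lookup⇒[]= v U eq , refl)
... | false = inj₂ ((λ v∈U → true≢false (trans (≡-sym ([]=⇒lookup v∈U)) eq)) , refl)
  where
  true≢false : true ≡ false → ⊥
  true≢false ()

memberSign : Bool → ℤ
memberSign true  = -1ℤ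
memberSign false = 1ℤ

∏-memberSign : ∀ {n} (U : Subset n) → ∏ (λ v → memberSign (lookup U v)) ≡ sign ∣ U ∣
∏-memberSign []ᵥ          = refl
∏-memberSign (true ∷ᵥ U)  = trans (-1*i≡-i _) (cong -_ (∏-memberSign U))
∏-memberSign (false ∷ᵥ U) = trans (*-identityˡ _) (∏-memberSign U)

module FixedSet {n} (G : Graph n) (U : Subset n) where

  HasNeighbour : Fin n → Set
  HasNeighbour v = Σ (Fin n) λ u → u ∈ U × Adj G u v

  hasNeighbour? : ∀ v → Dec (HasNeighbour v)
  hasNeighbour? v = any? (λ u → (u ∈? U) ×-dec Adj? G u v)

  -- The condition that "U is an IDS of G[W]" imposes on the entry b = [v ∈ W].
  Local : Fin n → Bool → Set
  Local v b = (v ∈ U → b ≡ true) × (b ≡ true → v ∉ U → HasNeighbour v)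

  local? : ∀ v b → Dec (Local v b)
  local? v b = ((v ∈? U) →-dec (b Bool.≟ true)) ×-dec ((b Bool.≟ true) →-dec (¬? (v ∈? U) →-dec hasNeighbour? v))

  𝟙-IDS : ∀ W → 𝟙 (IsIDS? G W U) ≡ 𝟙 (Independent? G U) * ∏ (λ v → 𝟙 (local? v (lookup W v)))
  𝟙-IDS W = begin
      𝟙 (IsIDS? G W U)
        ≡⟨ 𝟙-⇔ to from (IsIDS? G W U) both ⟩
      𝟙 both
        ≡⟨ ≡-sym (𝟙-× (Independent? G U) (all? (λ v → local? v (lookup W v))) both) ⟩
      𝟙 (Independent? G U) * 𝟙 (all? (λ v → local? v (lookup W v)))
        ≡⟨ cong (𝟙 (Independent? G U) *_) (≡-sym (𝟙-∀ (λ v → local? v (lookup W v)) _)) ⟩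
      𝟙 (Independent? G U) * ∏ (λ v → 𝟙 (local? v (lookup W v))) ∎
    where
    open ≡-Reasoning
    both : Dec (Independent G U × (∀ v → Local v (lookup W v)))
    both = Independent? G U ×-dec all? (λ v → local? v (lookup W v))
    to : IsIDS G W U → Independent G U × (∀ v → Local v (lookup W v))
    to (U⊆W , indep , dom) = indep , λ v →
      (λ v∈U → []=⇒lookup (U⊆W v∈U)) , (λ v∈W v∉U → dom v (lookup⇒[]= v W v∈W) v∉U)
    from : Independent G U × (∀ v → Local v (lookup W v)) → IsIDS G W U
    from (indep , local) =
      (λ {v} v∈U → lookup⇒[]= v W (proj₁ (local v) v∈U)) , indep ,
      (λ v v∈W v∉U → proj₂ (local v) ([]=⇒lookup v∈W) v∉U)

  Unattached : Fin n → Set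
  Unattached v = v ∉ U → ¬ HasNeighbour v

  unattached? : ∀ v → Dec (Unattached v)
  unattached? v = ¬? (v ∈? U) →-dec ¬? (hasNeighbour? v)

  local-difference : ∀ v →
    𝟙 (local? v false) - 𝟙 (local? v true) ≡ memberSign (lookup U v) * 𝟙 (unattached? v)
  local-difference v with membership v U
  ... | inj₁ (v∈U , eq) rewrite eq = trans
      (cong₂ _-_ (𝟙-no (λ l → false≢true (proj₁ l v∈U)) (local? v false))
                 (𝟙-yes ((λ _ → refl) , (λ _ v∉U → ⊥-elim (v∉U v∈U))) (local? v true)))
      (cong (-1ℤ *_) (≡-sym (𝟙-yes (λ v∉U → ⊥-elim (v∉U v∈U)) (unattached? v))))
    where
    false≢true : false ≡ true → ⊥
    false≢true ()
  ... | inj₂ (v∉U , eq) rewrite eq = trans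
      (cong₂ _-_ (𝟙-yes ((λ v∈U → ⊥-elim (v∉U v∈U)) , (λ ())) (local? v false))
                 (𝟙-⇔ (λ l → proj₂ l refl v∉U) (λ nb → (λ _ → refl) , (λ _ _ → nb))
                      (local? v true) (hasNeighbour? v)))
      (≡-sym (trans (*-identityˡ _)
        (𝟙-¬ (λ ¬nb _ → ¬nb) (λ u → u v∉U) (unattached? v) (hasNeighbour? v))))

  𝟙-isolated : 𝟙 (Independent? G U) * 𝟙 (all? unattached?) ≡ 𝟙 (allIn? U (isolated? G))
  𝟙-isolated = trans (𝟙-× (Independent? G U) (all? unattached?) both)
                     (𝟙-⇔ to from both (allIn? U (isolated? G)))
    where
    both : Dec (Independent G U × (∀ v → Unattached v))
    both = Independent? G U ×-dec all? unattached?
    to : Independent G U × (∀ v → Unattached v) → AllIn U (Isolated G)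
    to (indep , unatt) v v∈U w v~w with w ∈? U
    ... | yes w∈U = indep v w v∈U w∈U v~w
    ... | no w∉U  = unatt w w∉U (v , v∈U , v~w)
    from : AllIn U (Isolated G) → Independent G U × (∀ v → Unattached v)
    from isolated = (λ u v u∈U _ → isolated u u∈U v) , (λ v _ (u , u∈U , u~v) → isolated u u∈U v u~v)

  alternating-IDS :
    Σₛ (λ W → sign ∣ W ∣ * 𝟙 (IsIDS? G W U)) ≡ sign ∣ U ∣ * 𝟙 (allIn? U (isolated? G))
  alternating-IDS = begin
      Σₛ (λ W → sign ∣ W ∣ * 𝟙 (IsIDS? G W U))
        ≡⟨ Σₛ-cong (λ W → trans (cong (sign ∣ W ∣ *_) (𝟙-IDS W)) (reorder (sign ∣ W ∣) i (L W))) ⟩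
      Σₛ (λ W → i * (sign ∣ W ∣ * L W))
        ≡⟨ Σₛ-* i (λ W → sign ∣ W ∣ * L W) ⟩
      i * Σₛ (λ W → sign ∣ W ∣ * L W)
        ≡⟨ cong (i *_) (alternating-product (λ v b → 𝟙 (local? v b))) ⟩
      i * ∏ (λ v → 𝟙 (local? v false) - 𝟙 (local? v true))
        ≡⟨ cong (i *_) (trans (∏-cong local-difference) (∏-distrib-* (λ v → memberSign (lookup U v)) (λ v → 𝟙 (unattached? v)))) ⟩
      i * (∏ (λ v → memberSign (lookup U v)) * ∏ (λ v → 𝟙 (unattached? v)))
        ≡⟨ cong₂ (λ s u → i * (s * u)) (∏-memberSign U) (𝟙-∀ unattached? (all? unattached?)) ⟩
      i * (sign ∣ U ∣ * 𝟙 (all? unattached?))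
        ≡⟨ reorder i (sign ∣ U ∣) (𝟙 (all? unattached?)) ⟩
      sign ∣ U ∣ * (i * 𝟙 (all? unattached?))
        ≡⟨ cong (sign ∣ U ∣ *_) 𝟙-isolated ⟩
      sign ∣ U ∣ * 𝟙 (allIn? U (isolated? G)) ∎
    where
    open ≡-Reasoning
    i : ℤ
    i = 𝟙 (Independent? G U)
    L : Subset n → ℤ
    L W = ∏ (λ v → 𝟙 (local? v (lookup W v)))
    reorder : ∀ s a p → s * (a * p) ≡ a * (s * p)
    reorder = solve-∀

open FixedSet using (alternating-IDS)

coeff-ID : ∀ {n} (G : Graph n) W k →
  coeff (ID G W) k ≡ Σₛ (λ U → 𝟙 (IsIDS? G W U) * δ ∣ U ∣ k)
coeff-ID {n} G W k = trans (coeff-polySum (λ U → X^ ∣ U ∣) (filter (IsIDS? G W) (allSubsets n)) k)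
  (trans (sumℤ-filter (IsIDS? G W) (λ U → δ ∣ U ∣ k) (allSubsets n)) (sumℤ-allSubsets n _))

coeff-alternating-ID : ∀ {n} (G : Graph n) k →
  coeff (polySum (map (λ W → sign ∣ W ∣ · ID G W) (allSubsets n))) k
    ≡ Σₛ (λ U → δ ∣ U ∣ k * Σₛ (λ W → sign ∣ W ∣ * 𝟙 (IsIDS? G W U)))
coeff-alternating-ID {n} G k = begin
    coeff (polySum (map (λ W → sign ∣ W ∣ · ID G W) (allSubsets n))) k
      ≡⟨ coeff-polySum _ (allSubsets n) k ⟩
    sumℤ (map (λ W → coeff (sign ∣ W ∣ · ID G W) k) (allSubsets n))
      ≡⟨ sumℤ-allSubsets n _ ⟩
    Σₛ (λ W → coeff (sign ∣ W ∣ · ID G W) k)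
      ≡⟨ Σₛ-cong (λ W → trans (coeff-· (sign ∣ W ∣) (ID G W) k) (cong (sign ∣ W ∣ *_) (coeff-ID G W k))) ⟩
    Σₛ (λ W → sign ∣ W ∣ * Σₛ (λ U → h W U))
      ≡⟨ Σₛ-cong (λ W → ≡-sym (Σₛ-* (sign ∣ W ∣) (h W))) ⟩
    Σₛ (λ W → Σₛ (λ U → sign ∣ W ∣ * h W U))
      ≡⟨ Σₛ-swap (λ W U → sign ∣ W ∣ * h W U) ⟩
    Σₛ (λ U → Σₛ (λ W → sign ∣ W ∣ * h W U))
      ≡⟨ Σₛ-cong (λ U → trans (Σₛ-cong (λ W → reorder (sign ∣ W ∣) (𝟙 (IsIDS? G W U)) (δ ∣ U ∣ k)))
                              (Σₛ-* (δ ∣ U ∣ k) (λ W → sign ∣ W ∣ * 𝟙 (IsIDS? G W U)))) ⟩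
    Σₛ (λ U → δ ∣ U ∣ k * Σₛ (λ W → sign ∣ W ∣ * 𝟙 (IsIDS? G W U))) ∎
  where
  open ≡-Reasoning
  h : Subset n → Subset n → ℤ
  h W U = 𝟙 (IsIDS? G W U) * δ ∣ U ∣ k
  reorder : ∀ s i d → s * (i * d) ≡ d * (s * i)
  reorder = solve-∀

mainTheorem7 : ∀ {n} (G : Graph n) →
    polySum (map (λ W → sign ∣ W ∣ · ID G W) (allSubsets n))
      ≈ᵖ ((+ 1 ∷ - (+ 1) ∷ []) ^ᵖ iso G)
mainTheorem7 {n} G k = begin
    coeff (polySum (map (λ W → sign ∣ W ∣ · ID G W) (allSubsets n))) k
      ≡⟨ coeff-alternating-ID G k ⟩
    Σₛ (λ U → δ ∣ U ∣ k * Σₛ (λ W → sign ∣ W ∣ * 𝟙 (IsIDS? G W U)))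
      ≡⟨ Σₛ-cong (λ U → cong (δ ∣ U ∣ k *_) (alternating-IDS G U)) ⟩
    alternatingWithin (isolated? G) k
      ≡⟨ alternating-within (isolated? G) k ⟩
    coeff (oneMinusX ^ᵖ count (isolated? G)) k
      ≡⟨ cong (λ m → coeff (oneMinusX ^ᵖ m) k) (≡-sym (iso≡count G)) ⟩
    coeff (oneMinusX ^ᵖ iso G) k ∎
  where open ≡-Reasoning
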